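{- Let $D=(F,T)\in\mathcal D_k$ and let $H,H'$ be graphs. Suppose that for all graphs $G\supseteq F$ with $V(G)=V(F)$ and $(G,T)\in\mathcal D_k$ we have $\mathrm{pi\text{ - }hom}((G,T),H)=\mathrm{pi\text{ - }hom}((G,T),H')$. Then $\mathrm{pp\text{ - }hom}(D,H)=\mathrm{pp\text{ - }hom}(D,H')$.
   Context: Graphs are finite, undirected, vertex-coloured triples $(V(G),E(G),\gamma^G)$. $G\supseteq F$ means $F$ is a subgraph of $G$ (vertex and edge inclusion, colours agree). A homomorphism preserves edges and colours. A tree is a finite poset $(V(T),\preceq)$ with a unique minimal element in which each $\{u:u\preceq t\}$ is a chain; height = maximum number of elements in a chain. An elimination tree of a graph $F$ is a tree on $V(F)$ with $u\preceq v$ or $v\preceq u$ for every edge $uv$. $\mathcal D_k$ is the class of pairs $(F,T)$ with $F$ a graph and $T$ an elimination tree of $F$ of height at most $k$. A homomorphism $h:(F,T)\to H$ (homomorphism $F\to H$) is past-injective if $h(u)\ne h(v)$ whenever $u\prec^T v$; it is past-preserving if moreover for all $u\preceq^T v$: $uv\in E(F)\iff h(u)h(v)\in E(H)$. $\mathrm{pi\text{ - }hom}$ and $\mathrm{pp\text{ - }hom}$ count past-injective and past-preserving homomorphisms. -}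

module Defs where

open import Data.Nat using (ℕ; zero; suc; _≤_; _≡ᵇ_)
open import Data.Fin using (Fin; zero; suc; _≟_)
open import Data.Bool using (Bool; true; false; not; _∧_; _∨_)
open import Data.List using (List; []; _∷_; [_]; length; map; concatMap; allFin; filterᵇ)
open import Data.List.Membership.Propositional using (_∈_)
open import Data.List.Relation.Unary.Unique.Propositional using (Unique)
open import Data.Product using (_×_; Σ)
open import Data.Sum using (_⊎_)
open import Relation.Binary.PropositionalEquality using (_≡_)
open import Relation.Nullary.Decidable using (⌊_⌋)
import Data.Vec.Functional as VF
open import Data.Bool.ListAction using (and)

record Graph (n : ℕ) : Set where
  field
    adj    : Fin n → Fin n → Bool
    col    : Fin n → ℕ
    sym    : ∀ u v → adj u v ≡ adj v u
    irrefl : ∀ u → adj u u ≡ false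
open Graph public

_⊇_ : ∀ {n} → Graph n → Graph n → Set
G ⊇ F = (∀ u → col G u ≡ col F u) × (∀ u v → adj F u v ≡ true → adj G u v ≡ true)

record Tree (n : ℕ) : Set where
  field
    le      : Fin n → Fin n → Bool
    refl    : ∀ u → le u u ≡ true
    antisym : ∀ u v → le u v ≡ true → le v u ≡ true → u ≡ v
    trans   : ∀ u v w → le u v ≡ true → le v w ≡ true → le u w ≡ true
    root    : Fin n
    rootMin : ∀ u → le u root ≡ true → u ≡ root
    rootUnique : ∀ r → (∀ u → le u r ≡ true → u ≡ r) → r ≡ root
    downChain : ∀ t u v → le u t ≡ true → le v t ≡ true → le u v ≡ true ⊎ le v u ≡ true
open Tree public

lt : ∀ {n} → Tree n → Fin n → Fin n → Bool
lt T u v = le T u v ∧ not ⌊ u ≟ v ⌋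

Comparable : ∀ {n} → Tree n → Fin n → Fin n → Set
Comparable T u v = le T u v ≡ true ⊎ le T v u ≡ true

IsChain : ∀ {n} → Tree n → List (Fin n) → Set
IsChain T c = Unique c × (∀ x y → x ∈ c → y ∈ c → Comparable T x y)

HeightAtMost : ∀ {n} → Tree n → ℕ → Set
HeightAtMost T k = ∀ c → IsChain T c → length c ≤ k

IsEliminationTree : ∀ {n} → Graph n → Tree n → Set
IsEliminationTree F T = ∀ u v → adj F u v ≡ true → Comparable T u v

InD : ℕ → ∀ {n} → Graph n → Tree n → Set
InD k F T = IsEliminationTree F T × HeightAtMost T k

allFuns : ∀ n m → List (Fin n → Fin m)
allFuns zero    m = [ (λ ()) ]
allFuns (suc n) m = concatMap (λ f → map (λ i → i VF.∷ f) (allFin m)) (allFuns n m)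

allV : ∀ {n} → (Fin n → Bool) → Bool
allV {n} p = and (map p (allFin n))

iffB : Bool → Bool → Bool
iffB true  b = b
iffB false b = not b

isHom : ∀ {n m} → Graph n → Graph m → (Fin n → Fin m) → Bool
isHom F H h =
  allV (λ u → allV (λ v → not (adj F u v) ∨ adj H (h u) (h v)))
  ∧ allV (λ u → col F u ≡ᵇ col H (h u))

isPastInj : ∀ {n m} → Tree n → (Fin n → Fin m) → Bool
isPastInj T h = allV (λ u → allV (λ v → not (lt T u v) ∨ not ⌊ h u ≟ h v ⌋))

isPastPres : ∀ {n m} → Graph n → Tree n → Graph m → (Fin n → Fin m) → Bool
isPastPres F T H h =
  isPastInj T h ∧ allV (λ u → allV (λ v → not (le T u v) ∨ iffB (adj F u v) (adj H (h u) (h v))))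

count : ∀ {n m} → ((Fin n → Fin m) → Bool) → ℕ
count {n} {m} p = length (filterᵇ p (allFuns n m))

piHom : ∀ {n m} → Graph n → Tree n → Graph m → ℕ
piHom F T H = count (λ h → isHom F H h ∧ isPastInj T h)

ppHom : ∀ {n m} → Graph n → Tree n → Graph m → ℕ
ppHom F T H = count (λ h → isHom F H h ∧ isPastPres F T H h)

-- A past-injective homomorphism F → H is past-preserving exactly when it sends
-- every T-comparable non-edge uv of F to a non-edge of H.  Among the
-- homomorphisms avoiding a list P of such pairs, those sending uv to an edge are
-- exactly the homomorphisms of F + uv, so
--   #avoiding(F, uv ∷ P) = #avoiding(F, P) − #avoiding(F + uv, P).
-- As T stays an elimination tree of F + uv, of the same height, removing the
-- pairs one at a time expresses pp-hom(D, H) through the numbers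
-- pi-hom((G, T), H) for supergraphs (G, T) ∈ 𝒟_k of F, which agree for H and H′.
module Submission where

open import Defs hiding (refl; sym; trans)
open import Algebra.Bundles using (CommutativeMonoid)
import Algebra.Properties.CommutativeSemigroup as CommutativeSemigroupProperties
open import Data.Bool using (Bool; true; false; not; _∧_; _∨_; T; T?)
import Data.Bool as Bool
open import Data.Bool.ListAction using (all)
open import Data.Bool.Properties using (T-≡; ∧-assoc; ∧-identityʳ; ∧-conicalˡ; ∨-zeroʳ; ∧-commutativeMonoid)
open import Data.Fin using (Fin; _≟_)
open import Data.List using (List; []; _∷_; length; filter; filterᵇ; allFin; cartesianProduct)
open import Data.List.Membership.Propositional using (_∈_)
open import Data.List.Membership.Propositional.Properties using (∈-allFin; ∈-cartesianProduct⁺; ∈-filter⁺)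
open import Data.List.Properties using (filter-≐)
open import Data.List.Relation.Unary.All using (All; _∷_; lookup; tabulate)
open import Data.List.Relation.Unary.All.Properties using (all⁺; all⁻; all-filter)
open import Data.Nat using (ℕ; suc; _+_; _≡ᵇ_)
open import Data.Nat.Properties using (+-suc; +-cancelˡ-≡)
open import Data.Product using (_×_; _,_; proj₁; proj₂)
import Data.Product as Product
open import Data.Sum using (_⊎_; inj₁; inj₂)
import Data.Sum as Sum
open import Function using (_∘_)
open import Function.Bundles using (_⇔_; mk⇔; Equivalence)
open import Relation.Nullary using (¬_; ¬?; Dec; yes; no; does; _×-dec_; _⊎-dec_)
open import Relation.Nullary.Decidable using (dec-true; dec-false; does-⇔)
open import Relation.Binary.PropositionalEquality
  using (_≡_; _≢_; refl; sym; trans; cong; cong₂; subst; module ≡-Reasoning)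

open Equivalence using (to; from)
open ≡-Reasoning

module ∧ = CommutativeSemigroupProperties (CommutativeMonoid.commutativeSemigroup ∧-commutativeMonoid)

≡true-⇔⇒≡ : ∀ {x y : Bool} → (x ≡ true ⇔ y ≡ true) → x ≡ y
≡true-⇔⇒≡ {true}  {true}  _   = refl
≡true-⇔⇒≡ {true}  {false} x⇔y = sym (to x⇔y refl)
≡true-⇔⇒≡ {false} {true}  x⇔y = from x⇔y refl
≡true-⇔⇒≡ {false} {false} _   = refl

∧-true : ∀ {x y} → x ∧ y ≡ true ⇔ (x ≡ true × y ≡ true)
∧-true {true}  = mk⇔ (refl ,_) proj₂
∧-true {false} = mk⇔ (λ ()) (λ ())

∨-true⇒ : ∀ {x y} → x ∨ y ≡ true → x ≡ true ⊎ y ≡ true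
∨-true⇒ {true}  _ = inj₁ refl
∨-true⇒ {false} e = inj₂ e

implication-true : ∀ {x y} → not x ∨ y ≡ true ⇔ (x ≡ true → y ≡ true)
implication-true {true}  = mk⇔ (λ y _ → y) (λ f → f refl)
implication-true {false} = mk⇔ (λ _ ()) (λ _ → refl)

iffB-true : ∀ {x y} → iffB x y ≡ true ⇔ x ≡ y
iffB-true {true}  = mk⇔ sym sym
iffB-true {false} {true}  = mk⇔ (λ ()) (λ ())
iffB-true {false} {false} = mk⇔ (λ _ → refl) (λ _ → refl)

not-true : ∀ {x} → not x ≡ true ⇔ x ≡ false
not-true {true}  = mk⇔ (λ ()) (λ ())
not-true {false} = mk⇔ (λ _ → refl) (λ _ → refl)

∧-cong-if : ∀ x {y z} → (x ≡ true → y ≡ z) → x ∧ y ≡ x ∧ z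
∧-cong-if true  y≡z = y≡z refl
∧-cong-if false _   = refl

all-true : ∀ {A : Set} (p : A → Bool) xs → all p xs ≡ true ⇔ (∀ {x} → x ∈ xs → p x ≡ true)
all-true p xs = mk⇔ sound complete
  where
  sound : all p xs ≡ true → ∀ {x} → x ∈ xs → p x ≡ true
  sound e x∈xs = to T-≡ (lookup (all⁺ p xs (from T-≡ e)) x∈xs)
  complete : (∀ {x} → x ∈ xs → p x ≡ true) → all p xs ≡ true
  complete f = to T-≡ (all⁻ p (tabulate (from T-≡ ∘ f)))

allV²-true : ∀ {n} (p : Fin n → Fin n → Bool) → allV (λ u → allV (p u)) ≡ true ⇔ (∀ u v → p u v ≡ true)
allV²-true {n} p = mk⇔
  (λ e u v → to (all-true (p u) (allFin n)) (to (all-true row (allFin n)) e (∈-allFin u)) (∈-allFin v))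
  (λ f → from (all-true row (allFin n)) (λ {u} _ → from (all-true (p u) (allFin n)) (λ {v} _ → f u v)))
  where
  row : Fin n → Bool
  row u = allV (p u)

module _ {A : Set} where

  length-filterᵇ-cong : ∀ {p q : A → Bool} → (∀ x → p x ≡ q x) → ∀ xs →
                        length (filterᵇ p xs) ≡ length (filterᵇ q xs)
  length-filterᵇ-cong {p} {q} p≗q xs =
    cong length (filter-≐ (T? ∘ p) (T? ∘ q) (subst T (p≗q _) , subst T (sym (p≗q _))) xs)

  length-filterᵇ-split : ∀ (p b : A → Bool) xs →
    length (filterᵇ p xs) ≡ length (filterᵇ (λ x → p x ∧ b x) xs)
                           + length (filterᵇ (λ x → p x ∧ not (b x)) xs)
  length-filterᵇ-split p b []       = refl
  length-filterᵇ-split p b (x ∷ xs) with p x | b x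
  ... | true  | true  = cong suc (length-filterᵇ-split p b xs)
  ... | true  | false = trans (cong suc (length-filterᵇ-split p b xs)) (sym (+-suc _ _))
  ... | false | _     = length-filterᵇ-split p b xs

Joins : ∀ {n} → (u v x y : Fin n) → Set
Joins u v x y = (x ≡ u × y ≡ v) ⊎ (x ≡ v × y ≡ u)

joins? : ∀ {n} (u v x y : Fin n) → Dec (Joins u v x y)
joins? u v x y = (x ≟ u ×-dec y ≟ v) ⊎-dec (x ≟ v ×-dec y ≟ u)

Joins-sym : ∀ {n} {u v x y : Fin n} → Joins u v x y → Joins u v y x
Joins-sym = Sum.swap ∘ Sum.map Product.swap Product.swap

Joins-irrefl : ∀ {n} {u v x : Fin n} → u ≢ v → ¬ Joins u v x x
Joins-irrefl u≢v (inj₁ (refl , refl)) = u≢v refl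
Joins-irrefl u≢v (inj₂ (refl , refl)) = u≢v refl

does-true⇒ : ∀ {P : Set} (P? : Dec P) → does P? ≡ true → P
does-true⇒ (yes p) _ = p

addEdge : ∀ {n} (G : Graph n) (u v : Fin n) → u ≢ v → Graph n
addEdge G u v u≢v = record
  { adj    = λ x y → adj G x y ∨ does (joins? u v x y)
  ; col    = col G
  ; sym    = λ x y → cong₂ _∨_ (Graph.sym G x y)
                                 (does-⇔ (mk⇔ Joins-sym Joins-sym) (joins? u v x y) (joins? u v y x))
  ; irrefl = λ x → cong₂ _∨_ (Graph.irrefl G x) (dec-false (joins? u v x x) (Joins-irrefl u≢v))
  }

module _ {n} (G : Graph n) {u v : Fin n} (u≢v : u ≢ v) where

  addEdge-adj⇒ : ∀ {x y} → adj (addEdge G u v u≢v) x y ≡ true → adj G x y ≡ true ⊎ Joins u v x y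
  addEdge-adj⇒ {x} {y} e = Sum.map₂ (does-true⇒ (joins? u v x y)) (∨-true⇒ e)

  addEdge-⊇ : addEdge G u v u≢v ⊇ G
  addEdge-⊇ = (λ _ → refl) , λ x y e → cong (_∨ does (joins? u v x y)) e

  addEdge-adj-new : adj (addEdge G u v u≢v) u v ≡ true
  addEdge-adj-new =
    trans (cong (adj G u v ∨_) (dec-true (joins? u v u v) (inj₁ (refl , refl)))) (∨-zeroʳ _)

  addEdge-IsEliminationTree : ∀ {T : Tree n} → Comparable T u v →
                              IsEliminationTree G T → IsEliminationTree (addEdge G u v u≢v) T
  addEdge-IsEliminationTree u~v elim x y e with addEdge-adj⇒ e
  ... | inj₁ e′                  = elim x y e′
  ... | inj₂ (inj₁ (refl , refl)) = u~v
  ... | inj₂ (inj₂ (refl , refl)) = Sum.swap u~v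

  addEdge-InD : ∀ {k} {T : Tree n} → Comparable T u v → InD k G T → InD k (addEdge G u v u≢v) T
  addEdge-InD {T = T} u~v (elim , height) = addEdge-IsEliminationTree {T} u~v elim , height

⊇-refl : ∀ {n} {G : Graph n} → G ⊇ G
⊇-refl = (λ _ → refl) , (λ _ _ e → e)

⊇-trans : ∀ {n} {G G′ G″ : Graph n} → G″ ⊇ G′ → G′ ⊇ G → G″ ⊇ G
⊇-trans (col″ , adj″) (col′ , adj′) = (λ x → trans (col″ x) (col′ x)) , (λ x y → adj″ x y ∘ adj′ x y)

preservesEdges : ∀ {n m} → Graph n → Graph m → (Fin n → Fin m) → Bool
preservesEdges G H h = allV (λ x → allV (λ y → not (adj G x y) ∨ adj H (h x) (h y)))

preservesEdges-true : ∀ {n m} (G : Graph n) (H : Graph m) h →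
  preservesEdges G H h ≡ true ⇔ (∀ x y → adj G x y ≡ true → adj H (h x) (h y) ≡ true)
preservesEdges-true {n} G H h = mk⇔
  (λ e x y → to implication-true (to (allV²-true edgeOK) e x y))
  (λ f → from (allV²-true edgeOK) (λ x y → from implication-true (f x y)))
  where
  edgeOK : Fin n → Fin n → Bool
  edgeOK x y = not (adj G x y) ∨ adj H (h x) (h y)

module _ {n m} (G : Graph n) {u v : Fin n} (u≢v : u ≢ v) (H : Graph m) (h : Fin n → Fin m) where

  preservesEdges-addEdge :
    preservesEdges (addEdge G u v u≢v) H h ≡ preservesEdges G H h ∧ adj H (h u) (h v)
  preservesEdges-addEdge = ≡true-⇔⇒≡ (mk⇔ split join)
    where
    G⁺ : Graph n
    G⁺ = addEdge G u v u≢v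

    split : preservesEdges G⁺ H h ≡ true → preservesEdges G H h ∧ adj H (h u) (h v) ≡ true
    split e = from (∧-true {preservesEdges G H h})
      ( from (preservesEdges-true G H h) (λ x y a → preserves x y (proj₂ (addEdge-⊇ G u≢v) x y a))
      , preserves u v (addEdge-adj-new G u≢v) )
      where
      preserves : ∀ x y → adj G⁺ x y ≡ true → adj H (h x) (h y) ≡ true
      preserves = to (preservesEdges-true G⁺ H h) e

    join : preservesEdges G H h ∧ adj H (h u) (h v) ≡ true → preservesEdges G⁺ H h ≡ true
    join e = from (preservesEdges-true G⁺ H h) preserves
      where
      preservesG : ∀ x y → adj G x y ≡ true → adj H (h x) (h y) ≡ true
      preservesG = to (preservesEdges-true G H h) (proj₁ (to (∧-true {preservesEdges G H h}) e))
      uv↦edge : adj H (h u) (h v) ≡ true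
      uv↦edge = proj₂ (to (∧-true {preservesEdges G H h}) e)
      preserves : ∀ x y → adj G⁺ x y ≡ true → adj H (h x) (h y) ≡ true
      preserves x y a with addEdge-adj⇒ G u≢v a
      ... | inj₁ a′                   = preservesG x y a′
      ... | inj₂ (inj₁ (refl , refl)) = uv↦edge
      ... | inj₂ (inj₂ (refl , refl)) = trans (Graph.sym H (h v) (h u)) uv↦edge

  isHom-addEdge : isHom (addEdge G u v u≢v) H h ≡ isHom G H h ∧ adj H (h u) (h v)
  isHom-addEdge = begin
    preservesEdges (addEdge G u v u≢v) H h ∧ colours      ≡⟨ cong (_∧ colours) preservesEdges-addEdge ⟩
    (preservesEdges G H h ∧ adj H (h u) (h v)) ∧ colours  ≡⟨ ∧.xy∙z≈xz∙y (preservesEdges G H h) _ colours ⟩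
    (preservesEdges G H h ∧ colours) ∧ adj H (h u) (h v)  ∎
    where
    colours : Bool
    colours = allV (λ x → col G x ≡ᵇ col H (h x))

Pair : ℕ → Set
Pair n = Fin n × Fin n

avoids : ∀ {n m} → Graph m → List (Pair n) → (Fin n → Fin m) → Bool
avoids H P h = all (λ (x , y) → not (adj H (h x) (h y))) P

avoids-true : ∀ {n m} (H : Graph m) P (h : Fin n → Fin m) →
              avoids H P h ≡ true ⇔ (∀ {x y} → (x , y) ∈ P → adj H (h x) (h y) ≡ false)
avoids-true H P h = mk⇔
  (λ e {x} {y} xy∈P → to not-true (to (all-true _ P) e xy∈P))
  (λ f → from (all-true _ P) (λ {(x , y)} xy∈P → from not-true (f xy∈P)))

piHomAvoiding : ∀ {n m} → Graph n → Tree n → List (Pair n) → Graph m → ℕ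
piHomAvoiding G T P H = count (λ h → isHom G H h ∧ isPastInj T h ∧ avoids H P h)

module _ {n m} (G : Graph n) (T : Tree n) (H : Graph m) where

  piHomAvoiding-[] : piHomAvoiding G T [] H ≡ piHom G T H
  piHomAvoiding-[] =
    length-filterᵇ-cong (λ h → cong (isHom G H h ∧_) (∧-identityʳ (isPastInj T h))) (allFuns n m)

  piHomAvoiding-∷ : ∀ {u v} (u≢v : u ≢ v) P →
    piHomAvoiding (addEdge G u v u≢v) T P H + piHomAvoiding G T ((u , v) ∷ P) H ≡ piHomAvoiding G T P H
  piHomAvoiding-∷ {u} {v} u≢v P = sym (begin
    count q  ≡⟨ length-filterᵇ-split q uv↦edge (allFuns n m) ⟩
    count (λ h → q h ∧ uv↦edge h) + count (λ h → q h ∧ not (uv↦edge h))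
      ≡⟨ cong₂ _+_ (length-filterᵇ-cong edge (allFuns n m)) (length-filterᵇ-cong nonEdge (allFuns n m)) ⟩
    piHomAvoiding (addEdge G u v u≢v) T P H + piHomAvoiding G T ((u , v) ∷ P) H ∎)
    where
    rest : (Fin n → Fin m) → Bool
    rest h = isPastInj T h ∧ avoids H P h
    q uv↦edge : (Fin n → Fin m) → Bool
    q h = isHom G H h ∧ rest h
    uv↦edge h = adj H (h u) (h v)

    edge : ∀ h → q h ∧ uv↦edge h ≡ isHom (addEdge G u v u≢v) H h ∧ rest h
    edge h = begin
      (isHom G H h ∧ rest h) ∧ uv↦edge h ≡⟨ ∧.xy∙z≈xz∙y (isHom G H h) (rest h) (uv↦edge h) ⟩
      (isHom G H h ∧ uv↦edge h) ∧ rest h ≡⟨ cong (_∧ rest h) (sym (isHom-addEdge G u≢v H h)) ⟩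
      isHom (addEdge G u v u≢v) H h ∧ rest h ∎

    nonEdge : ∀ h → q h ∧ not (uv↦edge h) ≡ isHom G H h ∧ isPastInj T h ∧ not (uv↦edge h) ∧ avoids H P h
    nonEdge h = begin
      (isHom G H h ∧ rest h) ∧ not (uv↦edge h)   ≡⟨ ∧-assoc (isHom G H h) (rest h) _ ⟩
      isHom G H h ∧ rest h ∧ not (uv↦edge h)
        ≡⟨ cong (isHom G H h ∧_) (∧.xy∙z≈x∙zy (isPastInj T h) (avoids H P h) _) ⟩
      isHom G H h ∧ isPastInj T h ∧ not (uv↦edge h) ∧ avoids H P h ∎

ComparableNonEdge : ∀ {n} → Graph n → Tree n → Pair n → Set
ComparableNonEdge F T (u , v) = le T u v ≡ true × u ≢ v × adj F u v ≡ false

comparableNonEdge? : ∀ {n} (F : Graph n) (T : Tree n) p → Dec (ComparableNonEdge F T p)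
comparableNonEdge? F T (u , v) = le T u v Bool.≟ true ×-dec ¬? (u ≟ v) ×-dec adj F u v Bool.≟ false

allPairs : ∀ n → List (Pair n)
allPairs n = cartesianProduct (allFin n) (allFin n)

comparableNonEdges : ∀ {n} → Graph n → Tree n → List (Pair n)
comparableNonEdges {n} F T = filter (comparableNonEdge? F T) (allPairs n)

comparableNonEdges-sound : ∀ {n} (F : Graph n) (T : Tree n) →
                           All (ComparableNonEdge F T) (comparableNonEdges F T)
comparableNonEdges-sound {n} F T = all-filter (comparableNonEdge? F T) (allPairs n)

∈-comparableNonEdges : ∀ {n} (F : Graph n) (T : Tree n) {u v} →
                       ComparableNonEdge F T (u , v) → (u , v) ∈ comparableNonEdges F T
∈-comparableNonEdges F T {u} {v} =
  ∈-filter⁺ (comparableNonEdge? F T) (∈-cartesianProduct⁺ (∈-allFin u) (∈-allFin v))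

preservesComparableAdjacency : ∀ {n m} → Graph n → Tree n → Graph m → (Fin n → Fin m) → Bool
preservesComparableAdjacency F T H h =
  allV (λ u → allV (λ v → not (le T u v) ∨ iffB (adj F u v) (adj H (h u) (h v))))

module _ {n m} (F : Graph n) (T : Tree n) (H : Graph m) (h : Fin n → Fin m) where

  preservesComparableAdjacency-true : preservesComparableAdjacency F T H h ≡ true ⇔
    (∀ u v → le T u v ≡ true → adj F u v ≡ adj H (h u) (h v))
  preservesComparableAdjacency-true = mk⇔
    (λ e u v u≼v → to iffB-true (to implication-true (to (allV²-true ok) e u v) u≼v))
    (λ f → from (allV²-true ok) (λ u v → from implication-true (from iffB-true ∘ f u v)))
    where
    ok : Fin n → Fin n → Bool
    ok u v = not (le T u v) ∨ iffB (adj F u v) (adj H (h u) (h v))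

  preservesComparableAdjacency≡avoids : preservesEdges F H h ≡ true →
    preservesComparableAdjacency F T H h ≡ avoids H (comparableNonEdges F T) h
  preservesComparableAdjacency≡avoids hom = ≡true-⇔⇒≡ (mk⇔ sound complete)
    where
    sound : preservesComparableAdjacency F T H h ≡ true → avoids H (comparableNonEdges F T) h ≡ true
    sound e = from (avoids-true H _ h) λ {u} {v} uv∈ →
      let u≼v , _ , uv∉F = lookup (comparableNonEdges-sound F T) uv∈
      in trans (sym (to preservesComparableAdjacency-true e u v u≼v)) uv∉F

    complete : avoids H (comparableNonEdges F T) h ≡ true → preservesComparableAdjacency F T H h ≡ true
    complete e = from preservesComparableAdjacency-true adjacency
      where
      adjacency : ∀ u v → le T u v ≡ true → adj F u v ≡ adj H (h u) (h v)
      adjacency u v u≼v with u ≟ v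
      ... | yes refl = trans (Graph.irrefl F u) (sym (Graph.irrefl H (h u)))
      ... | no u≢v with adj F u v in uv
      ...   | true  = sym (to (preservesEdges-true F H h) hom u v uv)
      ...   | false = sym (to (avoids-true H _ h) e (∈-comparableNonEdges F T (u≼v , u≢v , uv)))

ppHom≡piHomAvoiding : ∀ {n m} (F : Graph n) (T : Tree n) (H : Graph m) →
                      ppHom F T H ≡ piHomAvoiding F T (comparableNonEdges F T) H
ppHom≡piHomAvoiding {n} {m} F T H = length-filterᵇ-cong agree (allFuns n m)
  where
  agree : ∀ h → isHom F H h ∧ isPastPres F T H h
              ≡ isHom F H h ∧ isPastInj T h ∧ avoids H (comparableNonEdges F T) h
  agree h = ∧-cong-if (isHom F H h) λ hom →
    cong (isPastInj T h ∧_) (preservesComparableAdjacency≡avoids F T H h (∧-conicalˡ _ _ hom))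

module _ (k : ℕ) {n m m′} (F : Graph n) (T : Tree n) (H : Graph m) (H′ : Graph m′)
         (piHom-agrees : (G : Graph n) → G ⊇ F → InD k G T → piHom G T H ≡ piHom G T H′) where

  piHomAvoiding-agrees : ∀ P → All (ComparableNonEdge F T) P → ∀ G → G ⊇ F → InD k G T →
                         piHomAvoiding G T P H ≡ piHomAvoiding G T P H′
  piHomAvoiding-agrees [] _ G G⊇F G∈𝒟 = begin
    piHomAvoiding G T [] H   ≡⟨ piHomAvoiding-[] G T H ⟩
    piHom G T H              ≡⟨ piHom-agrees G G⊇F G∈𝒟 ⟩
    piHom G T H′             ≡⟨ sym (piHomAvoiding-[] G T H′) ⟩
    piHomAvoiding G T [] H′  ∎
  piHomAvoiding-agrees ((u , v) ∷ P) ((u≼v , u≢v , _) ∷ P-ok) G G⊇F G∈𝒟 =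
    +-cancelˡ-≡ (piHomAvoiding G⁺ T P H) _ _ (begin
      piHomAvoiding G⁺ T P H + piHomAvoiding G T uvP H   ≡⟨ piHomAvoiding-∷ G T H u≢v P ⟩
      piHomAvoiding G T P H                              ≡⟨ piHomAvoiding-agrees P P-ok G G⊇F G∈𝒟 ⟩
      piHomAvoiding G T P H′                             ≡⟨ sym (piHomAvoiding-∷ G T H′ u≢v P) ⟩
      piHomAvoiding G⁺ T P H′ + piHomAvoiding G T uvP H′ ≡⟨ cong (_+ piHomAvoiding G T uvP H′) (sym agrees⁺) ⟩
      piHomAvoiding G⁺ T P H + piHomAvoiding G T uvP H′  ∎)
    where
    uvP : List (Pair n)
    uvP = (u , v) ∷ P
    G⁺ : Graph n
    G⁺ = addEdge G u v u≢v
    agrees⁺ : piHomAvoiding G⁺ T P H ≡ piHomAvoiding G⁺ T P H′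
    agrees⁺ = piHomAvoiding-agrees P P-ok G⁺ (⊇-trans {G = F} {G} {G⁺} (addEdge-⊇ G u≢v) G⊇F)
                                             (addEdge-InD G u≢v {k} {T} (inj₁ u≼v) G∈𝒟)

lemma14 : (k : ℕ) {n m m′ : ℕ} (F : Graph n) (T : Tree n) → InD k F T →
          (H : Graph m) (H′ : Graph m′) →
          ((G : Graph n) → G ⊇ F → InD k G T → piHom G T H ≡ piHom G T H′) →
          ppHom F T H ≡ ppHom F T H′
lemma14 k F T F∈𝒟 H H′ piHom-agrees = begin
  ppHom F T H                                    ≡⟨ ppHom≡piHomAvoiding F T H ⟩
  piHomAvoiding F T (comparableNonEdges F T) H   ≡⟨ piHomAvoiding-agrees k F T H H′ piHom-agrees
                                                      (comparableNonEdges F T) (comparableNonEdges-sound F T)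
                                                      F (⊇-refl {G = F}) F∈𝒟 ⟩
  piHomAvoiding F T (comparableNonEdges F T) H′  ≡⟨ sym (ppHom≡piHomAvoiding F T H′) ⟩
  ppHom F T H′                                   ∎
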